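{- Let $\Gamma$ be a $(c,m,d,k)$-unique expander with $cm \times m$ adjacency matrix $M$. For any positive integer $b$ define $\Gamma^{(b)}$ as the bipartite graph with block diagonal adjacency matrix $M^{(b)} = \operatorname{diag}(M,\dots,M)$ with $b$ blocks on the diagonal. Then $\Gamma^{(b)}$ is a $(c, bm, d, k)$-unique expander.
   Context: All graphs are bipartite with $cm$ vertices on the left side, $m$ vertices on the right side, and every left vertex has outdegree $d$; such a graph is specified by its edge function $\Gamma : [cm]\times[d] \to [m]$, where $[n]=\{0,1,\dots,n-1\}$. For a set $S$ of left vertices, $\Gamma(S)$ denotes the set of neighbors of $S$. The graph is $(c,m,d,k)$-unique if for every $S \subseteq [cm]$ with $|S|\le k$ there exists $y\in\Gamma(S)$ that has exactly one neighbor in $S$. The adjacency matrix has rows indexed by left vertices and columns by right vertices. -}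

module Defs where

open import Data.Nat using (ℕ; _*_; _≤_)
open import Data.Nat.Properties using (*-assoc; *-comm)
open import Data.Fin using (Fin; cast; combine; remQuot)
open import Data.Fin.Subset using (Subset; _∈_; ∣_∣; Nonempty)
open import Data.Product using (Σ; ∃; _×_; _,_)
open import Relation.Binary.PropositionalEquality using (_≡_; trans; sym; cong)

-- A bipartite graph with c*m left vertices, m right vertices, left outdegree d,
-- given by its edge function Γ : [cm] × [d] → [m].
Graph : ℕ → ℕ → ℕ → Set
Graph c m d = Fin (c * m) → Fin d → Fin m

Adj : ∀ c m d → Graph c m d → Fin (c * m) → Fin m → Set
Adj c m d Γ x y = Σ (Fin d) λ i → Γ x i ≡ y

UniqueNeighbour : ∀ c m d → Graph c m d → Subset (c * m) → Fin m → Set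
UniqueNeighbour c m d Γ S y =
  Σ (Fin (c * m)) λ x → x ∈ S × Adj c m d Γ x y ×
    (∀ x′ → x′ ∈ S → Adj c m d Γ x′ y → x′ ≡ x)

IsUnique : ∀ c m d → ℕ → Graph c m d → Set
IsUnique c m d k Γ =
  (S : Subset (c * m)) → Nonempty S → ∣ S ∣ ≤ k → Σ (Fin m) λ y → UniqueNeighbour c m d Γ S y

blocks-eq : ∀ b c m → c * (b * m) ≡ b * (c * m)
blocks-eq b c m = trans (sym (*-assoc c b m))
                 (trans (cong (_* m) (*-comm c b)) (*-assoc b c m))

-- Block-diagonal graph Γ^(b) with adjacency matrix diag(M,…,M) (b blocks):
-- left vertex j·(cm)+i (block j, inner vertex i) is sent to right vertex j·m + Γ(i,t).
blockDiag : ∀ c m d (b : ℕ) → Graph c m d → Graph c (b * m) d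
blockDiag c m d b Γ x t with remQuot {b} (c * m) (cast (blocks-eq b c m) x)
... | j , i = combine {b} {m} j (Γ i t)

-- A nonempty set S of left vertices of Γ^(b) meets some block j. Its trace on block j is a set of
-- left vertices of Γ of size at most |S| ≤ k, so it has a unique neighbour y in Γ. Edges of Γ^(b)
-- never leave their block, hence the copy of y in block j has exactly one neighbour in all of S.
module Submission where

open import Defs
open import Data.Nat using (ℕ; NonZero; suc; _*_; _+_; _≤_)
open import Data.Nat.Properties using (≤-trans; m≤m+n; m≤n+m; module ≤-Reasoning)
open import Data.Fin as Fin using (Fin; zero; suc; combine; remQuot; _↑ˡ_; _↑ʳ_)
open import Data.Fin.Properties using (cast-involutive; combine-remQuot; remQuot-combine; combine-injectiveˡ; combine-injectiveʳ)
open import Data.Fin.Subset using (Subset; _∈_; ∣_∣; inside; outside)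
open import Data.Vec as Vec using (Vec; []; _∷_; _++_; take; drop; lookup)
open import Data.Vec.Properties using (lookup-++ˡ; lookup-++ʳ; take++drop≡id; lookup-cast₁; cast-is-id; []=⇒lookup; lookup⇒[]=)
open import Data.Product using (∃₂; _,_; proj₁; proj₂)
open import Relation.Binary.PropositionalEquality using (_≡_; refl; sym; trans; cong; subst; module ≡-Reasoning)

private
  variable
    A : Set
    m n : ℕ

lookup-take : ∀ n (xs : Vec A (n + m)) (i : Fin n) → lookup (take n xs) i ≡ lookup xs (i ↑ˡ m)
lookup-take n xs i = begin
  lookup (take n xs) i                          ≡⟨ lookup-++ˡ (take n xs) (drop n xs) i ⟨
  lookup (take n xs ++ drop n xs) (i ↑ˡ _)      ≡⟨ cong (λ ys → lookup ys (i ↑ˡ _)) (take++drop≡id n xs) ⟩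
  lookup xs (i ↑ˡ _)                            ∎
  where open ≡-Reasoning

lookup-drop : ∀ n (xs : Vec A (n + m)) (i : Fin m) → lookup (drop n xs) i ≡ lookup xs (n ↑ʳ i)
lookup-drop n xs i = begin
  lookup (drop n xs) i                          ≡⟨ lookup-++ʳ (take n xs) (drop n xs) i ⟨
  lookup (take n xs ++ drop n xs) (n ↑ʳ i)      ≡⟨ cong (λ ys → lookup ys (n ↑ʳ i)) (take++drop≡id n xs) ⟩
  lookup xs (n ↑ʳ i)                            ∎
  where open ≡-Reasoning

∣p++q∣≡∣p∣+∣q∣ : (p : Subset m) (q : Subset n) → ∣ p ++ q ∣ ≡ ∣ p ∣ + ∣ q ∣
∣p++q∣≡∣p∣+∣q∣ []            q = refl
∣p++q∣≡∣p∣+∣q∣ (inside  ∷ p) q = cong suc (∣p++q∣≡∣p∣+∣q∣ p q)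
∣p++q∣≡∣p∣+∣q∣ (outside ∷ p) q = ∣p++q∣≡∣p∣+∣q∣ p q

∣take∣≤∣p∣ : ∀ n (p : Subset (n + m)) → ∣ take n p ∣ ≤ ∣ p ∣
∣take∣≤∣p∣ n p = begin
  ∣ take n p ∣                      ≤⟨ m≤m+n _ _ ⟩
  ∣ take n p ∣ + ∣ drop n p ∣       ≡⟨ ∣p++q∣≡∣p∣+∣q∣ (take n p) (drop n p) ⟨
  ∣ take n p ++ drop n p ∣          ≡⟨ cong ∣_∣ (take++drop≡id n p) ⟩
  ∣ p ∣                             ∎
  where open ≤-Reasoning

∣drop∣≤∣p∣ : ∀ n (p : Subset (n + m)) → ∣ drop n p ∣ ≤ ∣ p ∣
∣drop∣≤∣p∣ n p = begin
  ∣ drop n p ∣                      ≤⟨ m≤n+m _ _ ⟩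
  ∣ take n p ∣ + ∣ drop n p ∣       ≡⟨ ∣p++q∣≡∣p∣+∣q∣ (take n p) (drop n p) ⟨
  ∣ take n p ++ drop n p ∣          ≡⟨ cong ∣_∣ (take++drop≡id n p) ⟩
  ∣ p ∣                             ∎
  where open ≤-Reasoning

∣cast∣≡∣p∣ : (eq : m ≡ n) (p : Subset m) → ∣ Vec.cast eq p ∣ ≡ ∣ p ∣
∣cast∣≡∣p∣ refl p = cong ∣_∣ (cast-is-id refl p)

block : ∀ {b} (j : Fin b) → Vec A (b * n) → Vec A n
block {n = n} zero    xs = take n xs
block {n = n} (suc j) xs = block j (drop n xs)

lookup-block : ∀ {b} (j : Fin b) (xs : Vec A (b * n)) (i : Fin n) →
               lookup (block j xs) i ≡ lookup xs (combine j i)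
lookup-block {n = n} zero    xs i = lookup-take n xs i
lookup-block {n = n} (suc j) xs i = trans (lookup-block j (drop n xs) i) (lookup-drop n xs (combine j i))

∣block∣≤∣p∣ : ∀ {b} (j : Fin b) (p : Subset (b * n)) → ∣ block j p ∣ ≤ ∣ p ∣
∣block∣≤∣p∣ {n = n} zero    p = ∣take∣≤∣p∣ n p
∣block∣≤∣p∣ {n = n} (suc j) p = ≤-trans (∣block∣≤∣p∣ j (drop n p)) (∣drop∣≤∣p∣ n p)

∈-lookup : {p : Subset m} {q : Subset n} {x : Fin m} {y : Fin n} →
           lookup p x ≡ lookup q y → x ∈ p → y ∈ q
∈-lookup {q = q} {y = y} p[x]≡q[y] x∈p = lookup⇒[]= y q (trans (sym p[x]≡q[y]) ([]=⇒lookup x∈p))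

module BlockDiagonal (c m d b : ℕ) (Γ : Graph c m d) where

  Γᵇ : Graph c (b * m) d
  Γᵇ = blockDiag c m d b Γ

  -- Vertex i of block j; blockDiag reads blocks off after casting to Fin (b * (c * m)).
  blockVertex : Fin b → Fin (c * m) → Fin (c * (b * m))
  blockVertex j i = Fin.cast (sym (blocks-eq b c m)) (combine j i)

  blockVertex-surjective : ∀ x → ∃₂ λ j i → blockVertex j i ≡ x
  blockVertex-surjective x = j , i , (begin
    Fin.cast (sym eq) (combine j i)       ≡⟨ cong (Fin.cast (sym eq)) (combine-remQuot {b} (c * m) (Fin.cast eq x)) ⟩
    Fin.cast (sym eq) (Fin.cast eq x)     ≡⟨ cast-involutive (sym eq) eq x ⟩
    x                                     ∎)
    where
    open ≡-Reasoning
    eq = blocks-eq b c m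
    j = proj₁ (remQuot {b} (c * m) (Fin.cast eq x))
    i = proj₂ (remQuot {b} (c * m) (Fin.cast eq x))

  Γᵇ-blockVertex : ∀ j i t → Γᵇ (blockVertex j i) t ≡ combine j (Γ i t)
  -- The `with` in blockDiag on a pair pattern unfolds to the projections of remQuot.
  Γᵇ-blockVertex j i t = cong (λ (j′ , i′) → combine j′ (Γ i′ t)) remQuot-blockVertex
    where
    eq = blocks-eq b c m
    remQuot-blockVertex : remQuot {b} (c * m) (Fin.cast eq (blockVertex j i)) ≡ (j , i)
    remQuot-blockVertex = trans (cong (remQuot (c * m)) (cast-involutive eq (sym eq) (combine j i))) (remQuot-combine j i)

  restrict : Fin b → Subset (c * (b * m)) → Subset (c * m)
  restrict j S = block j (Vec.cast (blocks-eq b c m) S)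

  lookup-restrict : ∀ j S i → lookup (restrict j S) i ≡ lookup S (blockVertex j i)
  lookup-restrict j S i = trans (lookup-block j (Vec.cast eq S) i) (lookup-cast₁ eq S (combine j i))
    where eq = blocks-eq b c m

  ∈-restrict⁺ : ∀ {j S i} → blockVertex j i ∈ S → i ∈ restrict j S
  ∈-restrict⁺ {j} {S} {i} = ∈-lookup (sym (lookup-restrict j S i))

  ∈-restrict⁻ : ∀ {j S i} → i ∈ restrict j S → blockVertex j i ∈ S
  ∈-restrict⁻ {j} {S} {i} = ∈-lookup (lookup-restrict j S i)

  ∣restrict∣≤∣S∣ : ∀ j S → ∣ restrict j S ∣ ≤ ∣ S ∣
  ∣restrict∣≤∣S∣ j S = subst (∣ restrict j S ∣ ≤_) (∣cast∣≡∣p∣ (blocks-eq b c m) S) (∣block∣≤∣p∣ j (Vec.cast _ S))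

  uniqueNeighbour-blockDiag : ∀ j S y → UniqueNeighbour c m d Γ (restrict j S) y →
                              UniqueNeighbour c (b * m) d Γᵇ S (combine j y)
  uniqueNeighbour-blockDiag j S y (i , i∈Sⱼ , (t , Γit≡y) , unique) =
    blockVertex j i , ∈-restrict⁻ i∈Sⱼ , (t , trans (Γᵇ-blockVertex j i t) (cong (combine j) Γit≡y)) , uniqueᵇ
    where
    uniqueᵇ : ∀ x → x ∈ S → Adj c (b * m) d Γᵇ x (combine j y) → x ≡ blockVertex j i
    uniqueᵇ x x∈S (t′ , Γᵇxt′≡jy) with blockVertex-surjective x
    ... | j′ , i′ , refl = sameEdge (trans (sym (Γᵇ-blockVertex j′ i′ t′)) Γᵇxt′≡jy)
      where
      sameEdge : combine j′ (Γ i′ t′) ≡ combine j y → blockVertex j′ i′ ≡ blockVertex j i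
      sameEdge edge with refl ← combine-injectiveˡ j′ (Γ i′ t′) j y edge =
        cong (blockVertex j) (unique i′ (∈-restrict⁺ x∈S) (t′ , combine-injectiveʳ j (Γ i′ t′) j y edge))

  blockDiag-isUnique : ∀ {k} → IsUnique c m d k Γ → IsUnique c (b * m) d k Γᵇ
  blockDiag-isUnique unique S (x , x∈S) ∣S∣≤k with blockVertex-surjective x
  ... | j , i , refl with unique (restrict j S) (i , ∈-restrict⁺ x∈S) (≤-trans (∣restrict∣≤∣S∣ j S) ∣S∣≤k)
  ...   | y , yUnique = combine j y , uniqueNeighbour-blockDiag j S y yUnique

lemma4 : ∀ (c m d k b : ℕ) → .{{_ : NonZero b}} → (Γ : Graph c m d) →
    IsUnique c m d k Γ → IsUnique c (b * m) d k (blockDiag c m d b Γ)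
lemma4 c m d k b Γ = BlockDiagonal.blockDiag-isUnique c m d b Γ
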